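{- Let $M\in\mathbb{R}^{n\times d}$ and $S\in\mathbb{B}^{n\times d}$. Then $S$ is satisfiable with respect to $M$ if and only if every $A\in\mathbb{B}^{n\times d}$ with $A\preceq S$ and at most one entry equal to $1$ in each row is satisfiable with respect to $M$.
   Context: $\mathbb{B}^{n\times d}$ is the set of $n\times d$ Boolean matrices, ordered entrywise ($A\preceq B$ iff $A_{ij}\le B_{ij}$ for all $i,j$). For $a,y\in\mathbb{R}^n$, $\mathrm{Dom}_i(a)=\{y: y_i-a_i=\min_k(y_k-a_k)\}$. A point $x\in\mathbb{R}^n$ satisfies $S$ (with respect to $M$, with columns $M_{\star j}$) if $x\in\mathrm{Dom}_i(M_{\star j})$ for all $(i,j)$ with $S_{ij}=1$; $S$ is satisfiable if some point satisfies it. -}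

module Defs where

open import Level using (0ℓ)
open import Data.Bool using (Bool; true; false)
import Data.Bool as B
open import Data.Fin using (Fin)
open import Data.Product using (Σ; ∃; _×_)
open import Relation.Binary.PropositionalEquality using (_≡_; _≢_)
open import Relation.Nullary using (¬_)
open import Algebra.Structures using (IsCommutativeRing)
open import Relation.Binary.Structures using (IsTotalOrder)

-- The standard library has no real numbers; every model of this record is
-- (classically) isomorphic to ℝ, so quantifying over all models is faithful.
record RealField : Set₁ where
  infixl 6 _+_ _-_
  infixl 7 _*_
  infix 4 _≤_
  field
    ℝ     : Set
    0ℝ 1ℝ : ℝ
    _+_ _*_ : ℝ → ℝ → ℝ
    -_    : ℝ → ℝ
    _≤_   : ℝ → ℝ → Set
    isCommutativeRing : IsCommutativeRing _≡_ _+_ _*_ -_ 0ℝ 1ℝ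
    0≢1   : 0ℝ ≢ 1ℝ
    inverse : ∀ x → x ≢ 0ℝ → ∃ λ y → x * y ≡ 1ℝ
    isTotalOrder : IsTotalOrder _≡_ _≤_
    +-mono-≤ : ∀ {x y} z → x ≤ y → x + z ≤ y + z
    *-nonneg : ∀ {x y} → 0ℝ ≤ x → 0ℝ ≤ y → 0ℝ ≤ x * y
    complete : (P : ℝ → Set) → ∃ P → (∃ λ b → ∀ x → P x → x ≤ b) →
               ∃ λ s → (∀ x → P x → x ≤ s) × (∀ b → (∀ x → P x → x ≤ b) → s ≤ b)

  _-_ : ℝ → ℝ → ℝ
  x - y = x + (- y)

module _ (R : RealField) where
  open RealField R

  RMat : (n d : _) → Set
  RMat n d = Fin n → Fin d → ℝ

  BMat : (n d : _) → Set
  BMat n d = Fin n → Fin d → Bool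

  RVec : _ → Set
  RVec n = Fin n → ℝ

  -- y ∈ Dom_i(a)  iff  y_i - a_i = min_k (y_k - a_k),
  -- i.e. the (attained) value y_i - a_i is ≤ every y_k - a_k.
  Dom : ∀ {n} → Fin n → RVec n → RVec n → Set
  Dom {n} i a y = ∀ (k : Fin n) → y i - a i ≤ y k - a k

  Satisfies : ∀ {n d} → RMat n d → BMat n d → RVec n → Set
  Satisfies M S x = ∀ i j → S i j ≡ true → Dom i (λ k → M k j) x

  Satisfiable : ∀ {n d} → RMat n d → BMat n d → Set
  Satisfiable {n} M S = ∃ λ (x : RVec n) → Satisfies M S x

_⪯_ : ∀ {n d} → (Fin n → Fin d → Bool) → (Fin n → Fin d → Bool) → Set
A ⪯ S = ∀ i j → A i j B.≤ S i j

AtMostOnePerRow : ∀ {n d} → (Fin n → Fin d → Bool) → Set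
AtMostOnePerRow A = ∀ i j j' → A i j ≡ true → A i j' ≡ true → j ≡ j'

-- A point satisfies S iff it lies in every Dom_i(M_{⋆j}) with S_ij = 1.  Each Dom_i(a)
-- is closed under adding a constant and under pointwise maximum, and the maximum
-- x ⊔ z even stays in Dom_i(a) as soon as the summand attaining the maximum at
-- coordinate i does.  So if row i of S has two ones (i,j₁) and (i,j₂), x satisfies S
-- without (i,j₁) and z satisfies S without (i,j₂), translate z until z_i = x_i: then
-- x ⊔ z satisfies all of S.  Removing ones one at a time (induction on the number of
-- ones) reduces S to matrices with at most one 1 per row.
module Submission where

open import Defs
open import Data.Nat as Nat using (ℕ; zero; suc; z≤n; s≤s)
import Data.Nat.Properties as Nat
open import Data.Nat.Induction using (<-wellFounded)
open import Data.Bool as Bool using (Bool; true; false; if_then_else_)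
import Data.Bool.Properties as Bool
open import Data.Fin as Fin using (Fin; _≟_)
import Data.Fin.Properties as Fin
open import Data.Product using (Σ-syntax; _×_; _,_)
open import Data.Sum using (_⊎_; inj₁; inj₂)
open import Data.Empty using (⊥-elim)
open import Function.Base using (_on_)
open import Function.Bundles using (_⇔_; mk⇔)
open import Induction.WellFounded using (Acc; acc)
open import Relation.Binary.Construct.On using (wellFounded)
open import Relation.Binary.PropositionalEquality using (_≡_; _≢_; refl; sym; trans; cong; subst; subst₂)
open import Relation.Nullary using (yes; no; ¬?; _×-dec_)
open import Algebra.Bundles using (CommutativeRing)
open import Relation.Binary.Structures using (IsTotalOrder)

∑ : ∀ {m} → (Fin m → ℕ) → ℕ
∑ {zero}  f = 0
∑ {suc m} f = f Fin.zero Nat.+ ∑ (λ k → f (Fin.suc k))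

∑-mono-≤ : ∀ {m} {f g : Fin m → ℕ} → (∀ k → f k Nat.≤ g k) → ∑ f Nat.≤ ∑ g
∑-mono-≤ {zero}  f≤g = z≤n
∑-mono-≤ {suc m} f≤g = Nat.+-mono-≤ (f≤g Fin.zero) (∑-mono-≤ (λ k → f≤g (Fin.suc k)))

∑-mono-< : ∀ {m} {f g : Fin m → ℕ} → (∀ k → f k Nat.≤ g k) → ∀ k → f k Nat.< g k → ∑ f Nat.< ∑ g
∑-mono-< {suc m} f≤g Fin.zero    fk<gk = Nat.+-mono-<-≤ fk<gk (∑-mono-≤ (λ k → f≤g (Fin.suc k)))
∑-mono-< {suc m} f≤g (Fin.suc k) fk<gk = Nat.+-mono-≤-< (f≤g Fin.zero) (∑-mono-< (λ k → f≤g (Fin.suc k)) k fk<gk)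

indicator : Bool → ℕ
indicator b = if b then 1 else 0

indicator-mono-≤ : ∀ {a b} → a Bool.≤ b → indicator a Nat.≤ indicator b
indicator-mono-≤ Bool.b≤b = Nat.≤-refl
indicator-mono-≤ Bool.f≤t = z≤n

indicator-mono-< : ∀ {a b} → a Bool.< b → indicator a Nat.< indicator b
indicator-mono-< Bool.f<t = s≤s z≤n

true-mono : ∀ {a b} → a Bool.≤ b → a ≡ true → b ≡ true
true-mono Bool.b≤b a≡true = a≡true

module _ {n d : ℕ} where

  Matrix : Set
  Matrix = Fin n → Fin d → Bool

  ones : Matrix → ℕ
  ones S = ∑ λ p → ∑ λ q → indicator (S p q)

  ones-mono-< : ∀ {A S : Matrix} → A ⪯ S → ∀ p q → A p q Bool.< S p q → ones A Nat.< ones S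
  ones-mono-< A⪯S p q Apq<Spq =
    ∑-mono-< (λ p′ → ∑-mono-≤ (λ q′ → indicator-mono-≤ (A⪯S p′ q′)))
      p (∑-mono-< (λ q′ → indicator-mono-≤ (A⪯S p q′)) q (indicator-mono-< Apq<Spq))

  ⪯-refl : ∀ {S : Matrix} → S ⪯ S
  ⪯-refl p q = Bool.≤-refl

  ⪯-trans : ∀ {A S T : Matrix} → A ⪯ S → S ⪯ T → A ⪯ T
  ⪯-trans A⪯S S⪯T p q = Bool.≤-trans (A⪯S p q) (S⪯T p q)

  clear : Matrix → Fin n → Fin d → Matrix
  clear S i j p q with p ≟ i | q ≟ j
  ... | yes _ | yes _ = false
  ... | _     | _     = S p q

  clear-⪯ : ∀ S i j → clear S i j ⪯ S
  clear-⪯ S i j p q with p ≟ i | q ≟ j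
  ... | yes _ | yes _ = Bool.≤-minimum (S p q)
  ... | yes _ | no _  = Bool.≤-refl
  ... | no _  | _     = Bool.≤-refl

  clear-< : ∀ S {i j} → S i j ≡ true → clear S i j i j Bool.< S i j
  clear-< S {i} {j} Sij≡true with i ≟ i | j ≟ j
  ... | no i≢i  | _       = ⊥-elim (i≢i refl)
  ... | yes _   | no j≢j  = ⊥-elim (j≢j refl)
  ... | yes _   | yes _   = subst (false Bool.<_) (sym Sij≡true) Bool.f<t

  clear-true : ∀ S {i j p q} → S p q ≡ true → clear S i j p q ≡ true ⊎ (p ≡ i × q ≡ j)
  clear-true S {i} {j} {p} {q} Spq≡true with p ≟ i | q ≟ j
  ... | yes p≡i | yes q≡j = inj₂ (p≡i , q≡j)
  ... | yes _   | no _    = inj₁ Spq≡true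
  ... | no _    | _       = inj₁ Spq≡true

  TwoInRow : Matrix → Set
  TwoInRow S = Σ[ i ∈ Fin n ] Σ[ j₁ ∈ Fin d ] Σ[ j₂ ∈ Fin d ] j₁ ≢ j₂ × S i j₁ ≡ true × S i j₂ ≡ true

  atMostOnePerRow-or-twoInRow : ∀ S → AtMostOnePerRow S ⊎ TwoInRow S
  atMostOnePerRow-or-twoInRow S
    with Fin.any? (λ i → Fin.any? λ j₁ → Fin.any? λ j₂ →
           ¬? (j₁ ≟ j₂) ×-dec S i j₁ Bool.≟ true ×-dec S i j₂ Bool.≟ true)
  ... | yes (i , j₁ , j₂ , twoOnes) = inj₂ (i , j₁ , j₂ , twoOnes)
  ... | no noTwoOnes = inj₁ atMostOne
    where
    atMostOne : AtMostOnePerRow S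
    atMostOne i j₁ j₂ e₁ e₂ with j₁ ≟ j₂
    ... | yes j₁≡j₂ = j₁≡j₂
    ... | no j₁≢j₂  = ⊥-elim (noTwoOnes (i , j₁ , j₂ , j₁≢j₂ , e₁ , e₂))

module _ (R : RealField) where
  open RealField R
  open IsTotalOrder isTotalOrder using (total; reflexive) renaming (refl to ≤-refl; trans to ≤-trans)

  ℝ-commutativeRing : CommutativeRing _ _
  ℝ-commutativeRing = record { isCommutativeRing = isCommutativeRing }

  open CommutativeRing ℝ-commutativeRing using (+-identityˡ; -‿inverseʳ; +-commutativeSemigroup)
  open import Algebra.Properties.CommutativeSemigroup +-commutativeSemigroup using (xy∙z≈xz∙y)

  _⊔_ : ℝ → ℝ → ℝ
  x ⊔ y with total x y
  ... | inj₁ _ = y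
  ... | inj₂ _ = x

  ⊔-upperˡ : ∀ x y → x ≤ x ⊔ y
  ⊔-upperˡ x y with total x y
  ... | inj₁ x≤y = x≤y
  ... | inj₂ _   = ≤-refl

  ⊔-upperʳ : ∀ x y → y ≤ x ⊔ y
  ⊔-upperʳ x y with total x y
  ... | inj₁ _   = ≤-refl
  ... | inj₂ y≤x = y≤x

  ⊔-least : ∀ {x y z} → x ≤ z → y ≤ z → x ⊔ y ≤ z
  ⊔-least {x} {y} x≤z y≤z with total x y
  ... | inj₁ _ = y≤z
  ... | inj₂ _ = x≤z

  ⊔-sel : ∀ x y → x ⊔ y ≤ x ⊎ x ⊔ y ≤ y
  ⊔-sel x y with total x y
  ... | inj₁ _ = inj₂ ≤-refl
  ... | inj₂ _ = inj₁ ≤-refl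

  _⊔ᵥ_ : ∀ {m} → RVec R m → RVec R m → RVec R m
  (x ⊔ᵥ y) k = x k ⊔ y k

  module _ {m : ℕ} {p : Fin m} {a : RVec R m} where

    dom-+ : ∀ {x} t → Dom R p a x → Dom R p a (λ k → x k + t)
    dom-+ {x} t x∈D k =
      subst₂ _≤_ (xy∙z≈xz∙y (x p) (- a p) t) (xy∙z≈xz∙y (x k) (- a k) t) (+-mono-≤ t (x∈D k))

    dom-upward : ∀ {x y} → Dom R p a x → (∀ k → x k ≤ y k) → y p ≤ x p → Dom R p a y
    dom-upward x∈D x≤y yp≤xp k =
      ≤-trans (+-mono-≤ (- a p) yp≤xp) (≤-trans (x∈D k) (+-mono-≤ (- a k) (x≤y k)))

    dom-⊔ˡ : ∀ {x y} → y p ≤ x p → Dom R p a x → Dom R p a (x ⊔ᵥ y)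
    dom-⊔ˡ {x} {y} yp≤xp x∈D =
      dom-upward x∈D (λ k → ⊔-upperˡ (x k) (y k)) (⊔-least ≤-refl yp≤xp)

    dom-⊔ʳ : ∀ {x y} → x p ≤ y p → Dom R p a y → Dom R p a (x ⊔ᵥ y)
    dom-⊔ʳ {x} {y} xp≤yp y∈D =
      dom-upward y∈D (λ k → ⊔-upperʳ (x k) (y k)) (⊔-least xp≤yp ≤-refl)

    dom-⊔ : ∀ {x y} → Dom R p a x → Dom R p a y → Dom R p a (x ⊔ᵥ y)
    dom-⊔ {x} {y} x∈D y∈D with ⊔-sel (x p) (y p)
    ... | inj₁ ⊔≤x = dom-upward x∈D (λ k → ⊔-upperˡ (x k) (y k)) ⊔≤x
    ... | inj₂ ⊔≤y = dom-upward y∈D (λ k → ⊔-upperʳ (x k) (y k)) ⊔≤y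

  module _ {n d : ℕ} (M : RMat R n d) where

    satisfiable-antitone : ∀ {A S} → A ⪯ S → Satisfiable R M S → Satisfiable R M A
    satisfiable-antitone A⪯S (x , x⊨S) = x , λ i j Aij → x⊨S i j (true-mono (A⪯S i j) Aij)

    satisfies-+ : ∀ {S x} t → Satisfies R M S x → Satisfies R M S (λ k → x k + t)
    satisfies-+ t x⊨S i j Sij = dom-+ t (x⊨S i j Sij)

    satisfiable-of-clear-pair : ∀ S {i j₁ j₂} → j₁ ≢ j₂ →
      Satisfiable R M (clear S i j₁) → Satisfiable R M (clear S i j₂) → Satisfiable R M S
    satisfiable-of-clear-pair S {i} {j₁} {j₂} j₁≢j₂ (x , x⊨) (y , y⊨) = x ⊔ᵥ z , x⊔z⊨S
      where
      z : RVec R n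
      z k = (y k - y i) + x i

      z⊨ : Satisfies R M (clear S i j₂) z
      z⊨ = satisfies-+ (x i) (satisfies-+ (- y i) y⊨)

      zi≡xi : z i ≡ x i
      zi≡xi = trans (cong (_+ x i) (-‿inverseʳ (y i))) (+-identityˡ (x i))

      x⊔z⊨S : Satisfies R M S (x ⊔ᵥ z)
      x⊔z⊨S p q Spq with clear-true S {i} {j₁} Spq | clear-true S {i} {j₂} Spq
      ... | inj₁ kept₁          | inj₁ kept₂          = dom-⊔ (x⊨ p q kept₁) (z⊨ p q kept₂)
      ... | inj₂ (refl , refl)  | inj₁ kept₂          = dom-⊔ʳ (reflexive (sym zi≡xi)) (z⊨ p q kept₂)
      ... | inj₁ kept₁          | inj₂ (refl , refl)  = dom-⊔ˡ (reflexive zi≡xi) (x⊨ p q kept₁)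
      ... | inj₂ (_ , refl)     | inj₂ (_ , j₁≡j₂)    = ⊥-elim (j₁≢j₂ j₁≡j₂)

    SelectionsSatisfiable : BMat R n d → Set
    SelectionsSatisfiable S = ∀ A → A ⪯ S → AtMostOnePerRow A → Satisfiable R M A

    satisfiable-of-selections : ∀ S → Acc (Nat._<_ on ones) S → SelectionsSatisfiable S → Satisfiable R M S
    satisfiable-of-selections S (acc smaller) selections with atMostOnePerRow-or-twoInRow S
    ... | inj₁ atMostOne = selections S ⪯-refl atMostOne
    ... | inj₂ (i , j₁ , j₂ , j₁≢j₂ , Sij₁ , Sij₂) =
      satisfiable-of-clear-pair S j₁≢j₂ (satisfiable-of-clear Sij₁) (satisfiable-of-clear Sij₂)
      where
      satisfiable-of-clear : ∀ {j} → S i j ≡ true → Satisfiable R M (clear S i j)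
      satisfiable-of-clear {j} Sij =
        satisfiable-of-selections (clear S i j)
          (smaller (ones-mono-< (clear-⪯ S i j) i j (clear-< S Sij)))
          (λ A A⪯ → selections A (⪯-trans A⪯ (clear-⪯ S i j)))

corollary4p3 : (R : RealField) → (n d : ℕ) → (M : RMat R n d) → (S : BMat R n d) →
    Satisfiable R M S ⇔ (∀ (A : BMat R n d) → A ⪯ S → AtMostOnePerRow A → Satisfiable R M A)
corollary4p3 R n d M S = mk⇔
  (λ S-sat A A⪯S _ → satisfiable-antitone R M A⪯S S-sat)
  (satisfiable-of-selections R M S (wellFounded ones <-wellFounded S))
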